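{- For every $n\geq1$, $x_n^{(3)}=3n+1-b(n)$.
   Context: For a positive integer $m$, let $\nu_2(m)$ be the exponent of the highest power of $2$ dividing $m$. Define $x_1^{(3)}=3$ and, for $n\ge2$, $x_n^{(3)}$ is the smallest integer $y>x_{n-1}^{(3)}$ with $\nu_2(y)=\nu_2(n)$. $b(n)$ is the solution of the Josephus problem (OEIS A006257): for $n\ge1$, $b(n)=2\left(n-2^{\lfloor\log_2 n\rfloor}\right)+1$. -}

module Defs where

open import Data.Nat using (ℕ; zero; suc; _+_; _*_; _∸_; _^_; _<_; _≤_)
open import Data.Nat.Divisibility using (_∣_)
open import Data.Nat.Logarithm using (⌊log₂_⌋)
open import Data.Product using (_×_)
open import Relation.Nullary using (¬_)

Val2 : ℕ → ℕ → Set
Val2 m k = (2 ^ k ∣ m) × ¬ (2 ^ suc k ∣ m)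

-- Graph of the sequence x^{(3)}:  X n y  means  x_n^{(3)} = y  (n ≥ 1).
--   x_1 = 3;  x_n (n ≥ 2) is the smallest y > x_{n-1} with ν₂(y) = ν₂(n).
data X : ℕ → ℕ → Set where
  X-one  : X 1 3
  X-step : ∀ {n p y k}
         → X (suc n) p
         → Val2 (suc (suc n)) k
         → p < y
         → Val2 y k
         → (∀ z → p < z → z < y → ¬ Val2 z k)
         → X (suc (suc n)) y

b : ℕ → ℕ
b n = 2 * (n ∸ 2 ^ ⌊log₂ n ⌋) + 1

{-# OPTIONS --safe #-}
-- Split the indices into dyadic blocks 2^m ≤ n < 2^(m+1); on such a block
-- x_n = n + 2^(m+1).  Inside a block, n + 1 + 2^(m+1) has the same 2-adic
-- valuation as n + 1 because n + 1 < 2^(m+1), so x_{n+1} = x_n + 1.  Entering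
-- the block at n = 2^m we have x_{n-1} = 2^(m+1) - 1, whose successor 2^(m+1)
-- has valuation m + 1, so the next number of valuation m is 3·2^m.  Finally
-- 3n + 1 - b(n) = n + 2^(m+1) because ⌊log₂ n⌋ = m.
module Submission where

open import Defs
open import Data.Nat.Base
open import Data.Nat.Properties
open import Data.Nat.Divisibility
open import Data.Nat.Induction using (<-rec)
open import Data.Nat.Logarithm
open import Data.Nat.Tactic.RingSolver using (solve-∀)
open import Data.Product using (∃; _×_; _,_)
open import Relation.Nullary using (¬_; yes; no; contradiction)
open import Relation.Nullary.Decidable using (from-no)
open import Relation.Binary.PropositionalEquality

2*n≡n+n : ∀ n → 2 * n ≡ n + n
2*n≡n+n n = cong (n +_) (+-identityʳ n)

⌊n/2⌋+⌊n/2⌋≤n : ∀ n → ⌊ n /2⌋ + ⌊ n /2⌋ ≤ n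
⌊n/2⌋+⌊n/2⌋≤n n = subst (⌊ n /2⌋ + ⌊ n /2⌋ ≤_) (⌊n/2⌋+⌈n/2⌉≡n n) (+-monoʳ-≤ ⌊ n /2⌋ (⌊n/2⌋≤⌈n/2⌉ n))

2*m≤n⇒m≤⌊n/2⌋ : ∀ {m n} → 2 * m ≤ n → m ≤ ⌊ n /2⌋
2*m≤n⇒m≤⌊n/2⌋ {m} {n} 2m≤n = subst (_≤ ⌊ n /2⌋) (sym (n≡⌊n+n/2⌋ m)) (⌊n/2⌋-mono (subst (_≤ n) (2*n≡n+n m) 2m≤n))

n<2*m⇒⌊n/2⌋<m : ∀ {m n} → n < 2 * m → ⌊ n /2⌋ < m
n<2*m⇒⌊n/2⌋<m {m} {n} n<2m = ≰⇒> λ m≤⌊n/2⌋ →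
  <⇒≱ (≤-<-trans (⌊n/2⌋+⌊n/2⌋≤n n) (subst (n <_) (2*n≡n+n m) n<2m)) (+-mono-≤ m≤⌊n/2⌋ m≤⌊n/2⌋)

dyadic-block : ∀ n → 1 ≤ n → ∃ λ m → 2 ^ m ≤ n × n < 2 ^ suc m
dyadic-block (suc zero)    _ = 0 , ≤-refl , s≤s (s≤s z≤n)
dyadic-block (suc (suc n)) _ with dyadic-block (suc n) z<s
... | m , 2^m≤1+n , 1+n<2^[1+m] with suc (suc n) <? 2 ^ suc m
...   | yes 2+n<2^[1+m] = m , m≤n⇒m≤1+n 2^m≤1+n , 2+n<2^[1+m]
...   | no  2+n≮2^[1+m] = suc m , 2^[1+m]≤2+n , subst (_< 2 ^ suc (suc m)) (sym 2+n≡2^[1+m])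
                             (^-monoʳ-< 2 (s≤s (s≤s z≤n)) (n<1+n (suc m)))
  where
  2^[1+m]≤2+n : 2 ^ suc m ≤ suc (suc n)
  2^[1+m]≤2+n = ≮⇒≥ 2+n≮2^[1+m]

  2+n≡2^[1+m] : suc (suc n) ≡ 2 ^ suc m
  2+n≡2^[1+m] = ≤-antisym 1+n<2^[1+m] 2^[1+m]≤2+n

⌊log₂⌋-block : ∀ m {n} → 2 ^ m ≤ n → n < 2 ^ suc m → ⌊log₂ n ⌋ ≡ m
⌊log₂⌋-block zero {suc zero}    _ _ = ⌊log₂[2^n]⌋≡n 0
⌊log₂⌋-block zero {suc (suc n)} _ (s≤s (s≤s ()))
⌊log₂⌋-block (suc m) {n} 2^[1+m]≤n n<2^[2+m] with ⌊log₂ n ⌋ | lower | halved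
  where
  lower : suc m ≤ ⌊log₂ n ⌋
  lower = subst (_≤ ⌊log₂ n ⌋) (⌊log₂[2^n]⌋≡n (suc m)) (⌊log₂⌋-mono-≤ 2^[1+m]≤n)

  halved : ⌊log₂ n ⌋ ∸ 1 ≡ m
  halved = trans (sym (⌊log₂⌊n/2⌋⌋≡⌊log₂n⌋∸1 n))
                 (⌊log₂⌋-block m (2*m≤n⇒m≤⌊n/2⌋ 2^[1+m]≤n) (n<2*m⇒⌊n/2⌋<m n<2^[2+m]))
... | suc ℓ | _ | ℓ≡m = cong suc ℓ≡m

3*n+1∸[2*[n∸a]+1]≡n+2*a : ∀ {a n} → a ≤ n → 3 * n + 1 ∸ (2 * (n ∸ a) + 1) ≡ n + 2 * a
3*n+1∸[2*[n∸a]+1]≡n+2*a {a} a≤n with m≤n⇒∃[o]m+o≡n a≤n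
... | r , refl = begin
  3 * (a + r) + 1 ∸ (2 * (a + r ∸ a) + 1)     ≡⟨ cong (λ d → 3 * (a + r) + 1 ∸ (2 * d + 1)) (m+n∸m≡n a r) ⟩
  3 * (a + r) + 1 ∸ (2 * r + 1)               ≡⟨ cong (_∸ (2 * r + 1)) (regroup a r) ⟩
  a + r + 2 * a + (2 * r + 1) ∸ (2 * r + 1)   ≡⟨ m+n∸n≡m (a + r + 2 * a) (2 * r + 1) ⟩
  a + r + 2 * a                               ∎
  where
  open ≡-Reasoning

  regroup : ∀ a r → 3 * (a + r) + 1 ≡ a + r + 2 * a + (2 * r + 1)
  regroup = solve-∀

^-monoʳ-∣ : ∀ m {n o} → n ≤ o → m ^ n ∣ m ^ o
^-monoʳ-∣ m z≤n       = 1∣ _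
^-monoʳ-∣ m (s≤s n≤o) = *-monoʳ-∣ m (^-monoʳ-∣ m n≤o)

Val2-double : ∀ {h k} → Val2 h k → Val2 (2 * h) (suc k)
Val2-double (2^k∣h , 2^[1+k]∤h) =
  *-monoʳ-∣ 2 2^k∣h , λ 2^[2+k]∣2h → 2^[1+k]∤h (*-cancelˡ-∣ 2 2^[2+k]∣2h)

Val2-odd*2^ : ∀ {q} j → ¬ 2 ∣ q → Val2 (q * 2 ^ j) j
Val2-odd*2^ {q} j 2∤q = n∣m*n q , λ 2^[1+j]∣q2^j →
  2∤q (*-cancelʳ-∣ (2 ^ j) {{m^n≢0 2 j}} 2^[1+j]∣q2^j)

Val2-exists : ∀ n → 0 < n → ∃ (Val2 n)
Val2-exists = <-rec (λ n → 0 < n → ∃ (Val2 n)) go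
  where
  go : ∀ n → (∀ {m} → m < n → 0 < m → ∃ (Val2 m)) → 0 < n → ∃ (Val2 n)
  go n rec 0<n with 2 ∣? n
  ... | no 2∤n = 0 , 1∣ n , 2∤n
  ... | yes (divides-refl (suc h)) with rec (m<m*n (suc h) 2 (s≤s (s≤s z≤n))) z<s
  ...   | k , v = suc k , subst (λ m → Val2 m (suc k)) (*-comm 2 (suc h)) (Val2-double {k = k} v)

Val2-+-2^ : ∀ {x k} j → x < 2 ^ j → Val2 x k → Val2 (x + 2 ^ j) k
Val2-+-2^ {zero} {k} j _ (_ , 2^[1+k]∤0) = contradiction ((2 ^ suc k) ∣0) 2^[1+k]∤0
Val2-+-2^ {x@(suc _)} {k} j x<2^j (2^k∣x , 2^[1+k]∤x) =
  ∣m∣n⇒∣m+n 2^k∣x (^-monoʳ-∣ 2 (<⇒≤ k<j)) ,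
  λ 2^[1+k]∣x+2^j → 2^[1+k]∤x
    (∣m+n∣m⇒∣n (subst (2 ^ suc k ∣_) (+-comm x (2 ^ j)) 2^[1+k]∣x+2^j) (^-monoʳ-∣ 2 k<j))
  where
  k<j : k < j
  k<j = ≰⇒> λ j≤k → <⇒≱ (≤-<-trans (∣⇒≤ 2^k∣x) x<2^j) (^-monoʳ-≤ 2 j≤k)

X-next : ∀ {N p y k} → X N p → Val2 (suc N) k → p < y → Val2 y k
       → (∀ z → p < z → z < y → ¬ Val2 z k) → X (suc N) y
X-next {suc N} {k = k} x = X-step {k = k} x

X-next-adjacent : ∀ {N p k} → X N p → Val2 (suc N) k → Val2 (suc p) k → X (suc N) (suc p)
X-next-adjacent {k = k} x vN vp = X-next {k = k} x vN ≤-refl vp λ z p<z z<1+p _ → <⇒≱ p<z (≤-pred z<1+p)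

-- The only multiple of 2^j strictly between 2^(j+1) - 1 and 3·2^j is 2^(j+1).
X-next-power : ∀ {N p} j → X N p → suc N ≡ 2 ^ j → suc p ≡ 2 ^ suc j → X (suc N) (3 * 2 ^ j)
X-next-power {N} {p} j x 1+N≡2^j 1+p≡2^[1+j] =
  X-next {k = j} x (subst (λ n → Val2 n j) (sym 1+N≡2^j) Val2-2^j) p<3*2^j (Val2-odd*2^ j 2∤3) minimal
  where
  instance
    2^j≢0 : NonZero (2 ^ j)
    2^j≢0 = m^n≢0 2 j

  2∤3 : ¬ 2 ∣ 3
  2∤3 = from-no (2 ∣? 3)

  Val2-2^j : Val2 (2 ^ j) j
  Val2-2^j = subst (λ n → Val2 n j) (*-identityˡ (2 ^ j)) (Val2-odd*2^ j (from-no (2 ∣? 1)))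

  p<3*2^j : p < 3 * 2 ^ j
  p<3*2^j = subst (_≤ 3 * 2 ^ j) (sym 1+p≡2^[1+j]) (*-monoˡ-≤ (2 ^ j) {2} {3} (s≤s (s≤s z≤n)))

  minimal : ∀ z → p < z → z < 3 * 2 ^ j → ¬ Val2 z j
  minimal z p<z z<3*2^j (divides-refl q , 2^[1+j]∤z) = 2^[1+j]∤z (q≡2⇒2^[1+j]∣z q≡2)
    where
    2≤q : 2 ≤ q
    2≤q = *-cancelʳ-≤ 2 q (2 ^ j) (subst (_≤ q * 2 ^ j) 1+p≡2^[1+j] p<z)

    q<3 : q < 3
    q<3 = *-cancelʳ-< (2 ^ j) q 3 z<3*2^j

    q≡2 : q ≡ 2
    q≡2 = ≤-antisym (≤-pred q<3) 2≤q

    q≡2⇒2^[1+j]∣z : q ≡ 2 → 2 ^ suc j ∣ q * 2 ^ j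
    q≡2⇒2^[1+j]∣z refl = ∣-refl

X-on-block : ∀ m n → 2 ^ m ≤ n → n < 2 ^ suc m → X n (n + 2 ^ suc m)
X-on-block m       zero          2^m≤0 _ = contradiction 2^m≤0 (<⇒≱ (m^n>0 2 m))
X-on-block zero    (suc zero)    _     _ = X-one
X-on-block zero    (suc (suc N)) _     (s≤s (s≤s ()))
X-on-block (suc m) (suc N) 2^[1+m]≤1+N 1+N<2^[2+m] with 2 ^ suc m ≤? N
... | yes 2^[1+m]≤N with Val2-exists (suc N) z<s
...   | k , v = X-next-adjacent {k = k}
                  (X-on-block (suc m) N 2^[1+m]≤N (<-trans (n<1+n N) 1+N<2^[2+m]))
                  v (Val2-+-2^ {k = k} (suc (suc m)) 1+N<2^[2+m] v)
X-on-block (suc m) (suc N) 2^[1+m]≤1+N _ | no 2^[1+m]≰N =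
  subst (X (suc N)) (cong (_+ 2 ^ suc (suc m)) (sym 1+N≡a))
    (X-next-power (suc m) (X-on-block m N 2^m≤N N<a) 1+N≡a 1+N+a≡2a)
  where
  a = 2 ^ suc m

  1+N≡a : suc N ≡ a
  1+N≡a = ≤-antisym (≰⇒> 2^[1+m]≰N) 2^[1+m]≤1+N

  N<a : N < a
  N<a = ≤-reflexive 1+N≡a

  2^m≤N : 2 ^ m ≤ N
  2^m≤N = ≤-pred (subst (2 ^ m <_) (sym 1+N≡a) (^-monoʳ-< 2 (s≤s (s≤s z≤n)) (n<1+n m)))

  1+N+a≡2a : suc N + a ≡ 2 * a
  1+N+a≡2a = trans (cong (_+ a) 1+N≡a) (sym (2*n≡n+n a))

corollary3 : ∀ (n : ℕ) → 1 ≤ n → X n (3 * n + 1 ∸ b n)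
corollary3 n 1≤n with dyadic-block n 1≤n
... | m , 2^m≤n , n<2^[1+m] = subst (X n) (sym 3*n+1∸b[n]≡n+2^[1+m]) (X-on-block m n 2^m≤n n<2^[1+m])
  where
  3*n+1∸b[n]≡n+2^[1+m] : 3 * n + 1 ∸ b n ≡ n + 2 ^ suc m
  3*n+1∸b[n]≡n+2^[1+m] = trans (cong (λ ℓ → 3 * n + 1 ∸ (2 * (n ∸ 2 ^ ℓ) + 1)) (⌊log₂⌋-block m 2^m≤n n<2^[1+m]))
             (3*n+1∸[2*[n∸a]+1]≡n+2*a 2^m≤n)
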